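{- Let $(\lambda,s,t)$ be a doubly marked partition of $n$ with spt-crank $m$, where $\lambda=(\lambda_1,\dots,\lambda_\ell)$, and let $$\alpha=(\lambda_1-t+s-1,\ \dots,\ \lambda_{\lambda'_s}-t+s-1,\ \lambda_{\lambda'_s+1},\ \dots,\ \lambda_\ell),\qquad \beta=(\lambda'_s,\lambda'_{s+1},\dots,\lambda'_t).$$ Then: (1) the rank-set of $\alpha$ contains $m$; (2) if $j$ is the width of the $m$-Durfee rectangle of $\alpha$ and $h$ is the maximum integer such that $\alpha_{j+m+1+h}\ge h$, then $\beta_1=j+m+1+h$.
   Context: Partitions are written with weakly decreasing parts, with $\alpha_i=0$ for $i$ larger than the number of parts; $\lambda'$ is the conjugate of $\lambda$ (so $\lambda'_s$ is the number of parts of $\lambda$ that are $\ge s$), and $D(\lambda)$ is the side length of the Durfee square. A doubly marked partition of $n$ is a triple $(\lambda,s,t)$ with $\lambda$ a partition of $n$, $1\le s\le D(\lambda)$, $s\le t\le\lambda_1$, and $\lambda'_s=\lambda'_t$; with $g=\lambda'_s-s+1$, its spt-crank is $g-\lambda_g+t-s$. The rank-set of a partition $\alpha=(\alpha_1,\dots,\alpha_\ell)$ is the infinite sequence $[-\alpha_1,\,1-\alpha_2,\,\dots,\,j-\alpha_{j+1},\,\dots,\,\ell-1-\alpha_\ell,\,\ell,\,\ell+1,\dots]$. For an integer $m$ (possibly negative), the $m$-Durfee rectangle of $\alpha$ is the largest $(m+j)\times j$ rectangle ($m+j$ rows, $j$ columns) contained in the Ferrers diagram of $\alpha$, and $j$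 is its width; if $\ell(\alpha)\le m$ (so there is no such rectangle) the width is taken to be $j=0$. -}

module Defs where

open import Data.Nat using (ℕ; zero; suc; _≤_; _<_; _∸_; _≤?_)
open import Data.Integer as ℤ using (ℤ; +_)
open import Data.List using (List; []; _∷_; length; filter; map; take; drop; _++_; upTo)
open import Data.Nat.ListAction using (sum)
open import Data.List.Relation.Unary.All using (All)
open import Data.List.Relation.Unary.Linked using (Linked)
open import Data.Product using (Σ; _×_)
open import Relation.Binary.PropositionalEquality using (_≡_)
open import Relation.Nullary.Decidable using (does)
open import Data.Bool using (if_then_else_)

IsPartition : ℕ → List ℕ → Set
IsPartition n la = Linked (λ a b → b ≤ a) la × All (λ x → 0 < x) la × sum la ≡ n

-- 1-based part: part la i = la_i, and 0 when i exceeds the number of parts.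
-- (Index 0 is never used; it is set to 0.)
part : List ℕ → ℕ → ℕ
part [] _ = 0
part (x ∷ xs) zero = 0
part (x ∷ xs) (suc zero) = x
part (x ∷ xs) (suc (suc i)) = part xs (suc i)

conj : List ℕ → ℕ → ℕ
conj la s = length (filter (λ x → s ≤? x) la)

durfeeUpTo : List ℕ → ℕ → ℕ
durfeeUpTo la zero = 0
durfeeUpTo la (suc k) = if does (suc k ≤? part la (suc k)) then suc k else durfeeUpTo la k

durfee : List ℕ → ℕ
durfee la = durfeeUpTo la (length la)

IsDMP : ℕ → List ℕ → ℕ → ℕ → Set
IsDMP n la s t =
  IsPartition n la × (1 ≤ s) × (s ≤ durfee la) × (s ≤ t) × (t ≤ part la 1)
  × conj la s ≡ conj la t

gIdx : List ℕ → ℕ → ℕ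
gIdx la s = suc (conj la s ∸ s)

sptCrank : List ℕ → ℕ → ℕ → ℤ
sptCrank la s t =
  ((+ gIdx la s) ℤ.- (+ part la (gIdx la s))) ℤ.+ ((+ t) ℤ.- (+ s))

-- alpha = (la_1 - t + s - 1, …, la_{la'_s} - t + s - 1, la_{la'_s + 1}, …, la_ℓ)
-- (for a DMP, la_i ≥ t for i ≤ la'_s, so the truncated subtraction is exact)
alpha : List ℕ → ℕ → ℕ → List ℕ
alpha la s t =
  map (λ x → x ∸ suc (t ∸ s)) (take (conj la s) la) ++ drop (conj la s) la

beta : List ℕ → ℕ → ℕ → List ℕ
beta la s t = map (λ k → conj la (s Data.Nat.+ k)) (upTo (suc (t ∸ s)))

-- The rank-set of alpha: its k-th entry (k = 0,1,2,…) is k - alpha_{k+1}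
-- (this gives ℓ, ℓ+1, … for k ≥ ℓ since alpha_i = 0 there).
RankSetContains : List ℕ → ℤ → Set
RankSetContains α m = Σ ℕ (λ k → (+ k) ℤ.- (+ part α (suc k)) ≡ m)

RectFits : List ℕ → ℤ → ℕ → Set
RectFits α m j = (i : ℕ) → 1 ≤ i → (+ i) ℤ.≤ m ℤ.+ (+ j) → j ≤ part α i

IsDurfeeRectWidth : List ℕ → ℤ → ℕ → Set
IsDurfeeRectWidth α m j = RectFits α m j × ((j' : ℕ) → RectFits α m j' → j' ≤ j)

-- the condition α_{j+m+1+h} ≥ h (the index is positive whenever j is the width)
HCond : List ℕ → ℤ → ℕ → ℕ → Set
HCond α m j h = h ≤ part α ℤ.∣ (+ j) ℤ.+ m ℤ.+ (+ 1) ℤ.+ (+ h) ∣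

IsMaxH : List ℕ → ℤ → ℕ → ℕ → Set
IsMaxH α m j h = HCond α m j h × ((h' : ℕ) → HCond α m j h' → h' ≤ h)

-- Let c = λ'_s = λ'_t, k = c - s, so that g = k + 1, and d = t - s + 1.  Then α lowers the first
-- c rows of λ by d and keeps the rest, and the spt-crank is m = k - a with a = α_g = λ_g - d.
-- Hence m is the k-th entry of the rank-set of α.  Rows 1..k of α are at least a, and row k + 1
-- is exactly a, so the m-Durfee rectangle is the k × a rectangle and j = a.  Row c = k + s of α
-- is at least t - d = s - 1, while every later row of α is a row of λ past λ'_s, hence shorter
-- than s; so h = s - 1 and β₁ = c = j + m + 1 + h.
module Submission where

open import Defs
open import Data.Nat using (ℕ)
open import Data.Integer using (ℤ; +_; _+_)
open import Data.List using (List)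
open import Data.Product using (_×_)
open import Relation.Binary.PropositionalEquality using (_≡_)

open import Data.Nat as ℕ using (zero; suc; _≤_; _≰_; _<_; _≥_; _∸_; _≤?_; z≤n; s≤s)
open import Data.Nat.Properties
  using (≤-refl; ≤-trans; ≤-pred; ≤-antisym; ≤-reflexive; <⇒≤; <⇒≱; ≮⇒≥; <ᵇ-reflects-<;
         m≤m+n; m≤n+m; m≤n⇒m≤1+n; m<m+n; +-suc; +-identityʳ; +-monoʳ-<;
         0∸n≡0; ∸-monoˡ-≤; m<n⇒0<n∸m; m∸n+n≡m; m+[n∸m]≡n; m+n∸n≡m)
open import Data.Integer as ℤ using (_-_; ∣_∣; +≤+)
open import Data.Integer.Properties using (pos-+; drop‿+≤+; module ≤-Reasoning)
open import Data.Integer.Tactic.RingSolver using (solve-∀)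
open import Data.List using ([]; _∷_; length; map; take; drop; _++_)
open import Data.List.Properties using (filter-accept; filter-reject)
open import Data.List.Relation.Unary.Linked using (Linked; _∷_; tail)
open import Data.Product using (_,_)
open import Data.Bool using (true; false)
open import Relation.Binary.PropositionalEquality
  using (refl; sym; trans; cong; cong₂; subst; module ≡-Reasoning)
open import Relation.Nullary using (yes; no; ofʸ)
open import Relation.Nullary.Negation using (contradiction)

Descending : List ℕ → Set
Descending = Linked _≥_

part-≤-head : ∀ {y ys} → Descending (y ∷ ys) → ∀ i → part (y ∷ ys) i ≤ y
part-≤-head _ zero = z≤n
part-≤-head _ (suc zero) = ≤-refl
part-≤-head {ys = []} _ (suc (suc i)) = z≤n
part-≤-head {ys = _ ∷ _} (y≥z ∷ desc) (suc (suc i)) = ≤-trans (part-≤-head desc (suc i)) y≥z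

conj-∷-≤ : ∀ {x y ys} → x ≤ y → conj (y ∷ ys) x ≡ suc (conj ys x)
conj-∷-≤ x≤y = cong length (filter-accept (_ ≤?_) x≤y)

conj-∷-≰ : ∀ {x y ys} → x ≰ y → conj (y ∷ ys) x ≡ conj ys x
conj-∷-≰ x≰y = cong length (filter-reject (_ ≤?_) x≰y)

≤conj⇒≤part : ∀ {la x i} → Descending la → 1 ≤ i → i ≤ conj la x → x ≤ part la i
≤conj⇒≤part {[]} {i = suc _} _ _ ()
≤conj⇒≤part {y ∷ ys} {x} {suc i} desc _ i≤conj with x ≤? y
≤conj⇒≤part {y ∷ ys} {x} {suc zero} desc _ _ | yes x≤y = x≤y
≤conj⇒≤part {y ∷ ys} {x} {suc (suc i)} desc _ i≤conj | yes x≤y =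
  ≤conj⇒≤part (tail desc) (s≤s z≤n) (≤-pred (subst (suc (suc i) ≤_) (conj-∷-≤ x≤y) i≤conj))
... | no x≰y = contradiction
  (≤-trans (≤conj⇒≤part (tail desc) (s≤s z≤n) (subst (suc i ≤_) (conj-∷-≰ x≰y) i≤conj))
           (part-≤-head desc (suc (suc i))))
  x≰y

≤part⇒≤conj : ∀ {la x i} → Descending la → 1 ≤ x → x ≤ part la i → i ≤ conj la x
≤part⇒≤conj {[]} _ (s≤s _) ()
≤part⇒≤conj {y ∷ ys} {i = zero} _ _ _ = z≤n
≤part⇒≤conj {y ∷ ys} {x} {suc i} desc 1≤x x≤part with x ≤? y
... | no x≰y = contradiction (≤-trans x≤part (part-≤-head desc (suc i))) x≰y
... | yes x≤y = subst (suc i ≤_) (sym (conj-∷-≤ x≤y)) (s≤s (≤conj-tail i x≤part))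
  where
  ≤conj-tail : ∀ i → x ≤ part (y ∷ ys) (suc i) → i ≤ conj ys x
  ≤conj-tail zero _ = z≤n
  ≤conj-tail (suc i) x≤part = ≤part⇒≤conj (tail desc) 1≤x x≤part

part-antitone : ∀ {la i j} → Descending la → 1 ≤ i → i ≤ j → part la j ≤ part la i
part-antitone {la} {i} {j} desc 1≤i i≤j with part la j in eq
... | zero = z≤n
... | suc p = ≤conj⇒≤part desc 1≤i (≤-trans i≤j (≤part⇒≤conj desc (s≤s z≤n) (≤-reflexive (sym eq))))

≤durfeeUpTo⇒≤part : ∀ {la i} → Descending la → ∀ K → 1 ≤ i → i ≤ durfeeUpTo la K → i ≤ part la i
≤durfeeUpTo⇒≤part desc zero (s≤s _) ()
≤durfeeUpTo⇒≤part {la} desc (suc K) 1≤i i≤D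
  with K ℕ.<ᵇ part la (suc K) | <ᵇ-reflects-< K (part la (suc K))
... | true  | ofʸ K<part = ≤-trans i≤D (≤-trans K<part (part-antitone desc 1≤i i≤D))
... | false | _ = ≤durfeeUpTo⇒≤part desc K 1≤i i≤D

≤durfee⇒≤part : ∀ {la i} → Descending la → 1 ≤ i → i ≤ durfee la → i ≤ part la i
≤durfee⇒≤part {la} desc = ≤durfeeUpTo⇒≤part desc (length la)

-- alpha la s t unfolds to lowerPrefix (suc (t ∸ s)) (conj la s) la.
lowerPrefix : ℕ → ℕ → List ℕ → List ℕ
lowerPrefix d c la = map (_∸ d) (take c la) ++ drop c la

part-lowerPrefix-≤ : ∀ d c la {i} → 1 ≤ i → i ≤ c → part (lowerPrefix d c la) i ≡ part la i ∸ d
part-lowerPrefix-≤ d zero la (s≤s _) ()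
part-lowerPrefix-≤ d (suc c) [] _ _ = sym (0∸n≡0 d)
part-lowerPrefix-≤ d (suc c) (y ∷ ys) {suc zero} _ _ = refl
part-lowerPrefix-≤ d (suc c) (y ∷ ys) {suc (suc i)} _ (s≤s i≤c) = part-lowerPrefix-≤ d c ys (s≤s z≤n) i≤c

part-lowerPrefix-> : ∀ d c la {i} → c < i → part (lowerPrefix d c la) i ≡ part la i
part-lowerPrefix-> d zero la _ = refl
part-lowerPrefix-> d (suc c) [] _ = refl
part-lowerPrefix-> d (suc c) (y ∷ ys) {suc (suc i)} (s≤s c<i) = part-lowerPrefix-> d c ys c<i

greatest-unique : ∀ (P : ℕ → Set) {m n} →
  P m × (∀ i → P i → i ≤ m) → P n × (∀ i → P i → i ≤ n) → m ≡ n
greatest-unique P (Pm , ≤m) (Pn , ≤n) = ≤-antisym (≤n _ Pm) (≤m _ Pn)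

i-j+j≡i : ∀ (i j : ℤ) → i - j + j ≡ i
i-j+j≡i = solve-∀

k-a+[a+x]≡k+x : ∀ k a x → (+ k - + a) + + (a ℕ.+ x) ≡ + (k ℕ.+ x)
k-a+[a+x]≡k+x k a x rewrite pos-+ a x | pos-+ k x = identity (+ k) (+ a) (+ x)
  where
  identity : ∀ K A X → K - A + (A + X) ≡ K + X
  identity = solve-∀

a+[k-a]+1+x≡1+k+x : ∀ k a x → + a + (+ k - + a) + + 1 + + x ≡ + (suc k ℕ.+ x)
a+[k-a]+1+x≡1+k+x k a x rewrite pos-+ (suc k) x | pos-+ 1 k = identity (+ k) (+ a) (+ x)
  where
  identity : ∀ K A X → A + (K - A) + + 1 + X ≡ + 1 + K + X
  identity = solve-∀

[1+k-[a+1+e]]+[s+e-s]≡k-a : ∀ k a e s → (+ suc k - + (a ℕ.+ suc e)) + (+ (s ℕ.+ e) - + s) ≡ + k - + a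
[1+k-[a+1+e]]+[s+e-s]≡k-a k a e s rewrite pos-+ 1 k | pos-+ a (suc e) | pos-+ 1 e | pos-+ s e =
  identity (+ k) (+ a) (+ e) (+ s)
  where
  identity : ∀ K A E S → (+ 1 + K - (A + (+ 1 + E))) + (S + E - S) ≡ K - A
  identity = solve-∀

1+k≤k-a+j : ∀ {k a j} → a < j → + suc k ℤ.≤ (+ k - + a) + + j
1+k≤k-a+j {k} {a} {j} a<j = begin
  + suc k                         ≤⟨ +≤+ (m<m+n k (m<n⇒0<n∸m a<j)) ⟩
  + (k ℕ.+ (j ∸ a))               ≡⟨ k-a+[a+x]≡k+x k a (j ∸ a) ⟨
  (+ k - + a) + + (a ℕ.+ (j ∸ a)) ≡⟨ cong (λ x → (+ k - + a) + + x) (m+[n∸m]≡n (<⇒≤ a<j)) ⟩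
  (+ k - + a) + + j               ∎
  where open ≤-Reasoning

isDurfeeRectWidth : ∀ {α k a} → part α (suc k) ≤ a → (∀ {i} → 1 ≤ i → i ≤ k → a ≤ part α i) →
  IsDurfeeRectWidth α (+ k - + a) a
isDurfeeRectWidth {α} {k} {a} row≤a rows-above = fits , bounded
  where
  fits : RectFits α (+ k - + a) a
  fits i 1≤i i≤m+a = rows-above 1≤i (drop‿+≤+ (subst (+ i ℤ.≤_) (i-j+j≡i (+ k) (+ a)) i≤m+a))
  bounded : ∀ j → RectFits α (+ k - + a) j → j ≤ a
  bounded j fits-j = ≮⇒≥ λ a<j → <⇒≱ a<j (≤-trans (fits-j (suc k) (s≤s z≤n) (1+k≤k-a+j a<j)) row≤a)

isMaxH : ∀ {α k a h} → h ≤ part α (suc k ℕ.+ h) → (∀ {i} → suc k ℕ.+ h < i → part α i ≤ h) →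
  IsMaxH α (+ k - + a) a h
isMaxH {α} {k} {a} {h} h≤row rows-below = subst (h ≤_) (cong (part α) (row≡ h)) h≤row , bounded
  where
  row≡ : ∀ x → suc k ℕ.+ x ≡ ∣ + a + (+ k - + a) + + 1 + + x ∣
  row≡ x = cong ∣_∣ (sym (a+[k-a]+1+x≡1+k+x k a x))
  bounded : ∀ h' → HCond α (+ k - + a) a h' → h' ≤ h
  bounded h' hcond = ≮⇒≥ λ h<h' →
    <⇒≱ h<h' (≤-trans (subst (h' ≤_) (cong (part α) (sym (row≡ h'))) hcond)
                      (rows-below (+-monoʳ-< (suc k) h<h')))

module DoublyMarked {la : List ℕ} {s' t : ℕ} (desc : Descending la) (s≤durfee : suc s' ≤ durfee la)
                    (s≤t : suc s' ≤ t) (conj-s≡conj-t : conj la (suc s') ≡ conj la t) where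

  s c e d k a : ℕ
  s = suc s'
  c = conj la s
  e = t ∸ s
  d = suc e
  k = c ∸ s
  a = part la (suc k) ∸ d

  α : List ℕ
  α = alpha la s t

  m : ℤ
  m = + k - + a

  s≤c : s ≤ c
  s≤c = ≤part⇒≤conj desc (s≤s z≤n) (≤durfee⇒≤part desc (s≤s z≤n) s≤durfee)

  1+k+s'≡c : suc k ℕ.+ s' ≡ c
  1+k+s'≡c = trans (sym (+-suc k s')) (m∸n+n≡m s≤c)

  1+k≤c : suc k ≤ c
  1+k≤c = subst (suc k ≤_) 1+k+s'≡c (m≤m+n (suc k) s')

  t≡s+e : t ≡ s ℕ.+ e
  t≡s+e = sym (m+[n∸m]≡n s≤t)

  t≤part : ∀ {i} → 1 ≤ i → i ≤ c → t ≤ part la i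
  t≤part {i} 1≤i i≤c = ≤conj⇒≤part desc 1≤i (subst (i ≤_) conj-s≡conj-t i≤c)

  part≤s' : ∀ {i} → c < i → part la i ≤ s'
  part≤s' c<i = ≮⇒≥ λ s≤part → <⇒≱ c<i (≤part⇒≤conj desc (s≤s z≤n) s≤part)

  α-row-1+k : part α (suc k) ≡ a
  α-row-1+k = part-lowerPrefix-≤ d c la (s≤s z≤n) 1+k≤c

  a≤α-rows-above : ∀ {i} → 1 ≤ i → i ≤ k → a ≤ part α i
  a≤α-rows-above {i} 1≤i i≤k =
    subst (a ≤_) (sym (part-lowerPrefix-≤ d c la 1≤i (≤-trans i≤1+k 1+k≤c)))
      (∸-monoˡ-≤ d (part-antitone desc 1≤i i≤1+k))
    where
    i≤1+k : i ≤ suc k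
    i≤1+k = m≤n⇒m≤1+n i≤k

  s'≤α-row-c : s' ≤ part α (suc k ℕ.+ s')
  s'≤α-row-c rewrite 1+k+s'≡c | part-lowerPrefix-≤ d c la (≤-trans (s≤s z≤n) s≤c) ≤-refl =
    subst (_≤ part la c ∸ d) t∸d≡s' (∸-monoˡ-≤ d (t≤part (≤-trans (s≤s z≤n) s≤c) ≤-refl))
    where
    open ≡-Reasoning
    t∸d≡s' : t ∸ d ≡ s'
    t∸d≡s' = begin
      t ∸ d            ≡⟨ cong (_∸ d) t≡s+e ⟩
      s ℕ.+ e ∸ d      ≡⟨ cong (_∸ d) (sym (+-suc s' e)) ⟩
      s' ℕ.+ d ∸ d     ≡⟨ m+n∸n≡m s' d ⟩
      s'               ∎

  α-rows-below : ∀ {i} → suc k ℕ.+ s' < i → part α i ≤ s'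
  α-rows-below {i} row<i = subst (_≤ s') (sym (part-lowerPrefix-> d c la c<i)) (part≤s' c<i)
    where
    c<i : c < i
    c<i = subst (_< i) 1+k+s'≡c row<i

  sptCrank≡m : sptCrank la s t ≡ m
  sptCrank≡m = begin
    (+ suc k - + part la (suc k)) + (+ t - + s)
      ≡⟨ cong₂ (λ L u → (+ suc k - + L) + (+ u - + s)) L≡a+d t≡s+e ⟩
    (+ suc k - + (a ℕ.+ d)) + (+ (s ℕ.+ e) - + s) ≡⟨ [1+k-[a+1+e]]+[s+e-s]≡k-a k a e s ⟩
    m                                             ∎
    where
    open ≡-Reasoning
    d≤t : d ≤ t
    d≤t = subst (d ≤_) (sym t≡s+e) (s≤s (m≤n+m e s'))
    L≡a+d : part la (suc k) ≡ a ℕ.+ d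
    L≡a+d = sym (m∸n+n≡m (≤-trans d≤t (t≤part (s≤s z≤n) 1+k≤c)))

  rankSetContains : RankSetContains α m
  rankSetContains = k , cong (λ x → + k - + x) α-row-1+k

  β₁≡j+m+1+h : ∀ {j h} → IsDurfeeRectWidth α m j → IsMaxH α m j h →
    + part (beta la s t) 1 ≡ + j + m + + 1 + + h
  β₁≡j+m+1+h {j} {h} width maxH = begin
    + conj la (s ℕ.+ 0)    ≡⟨ cong (λ x → + conj la x) (+-identityʳ s) ⟩
    + c                    ≡⟨ cong +_ 1+k+s'≡c ⟨
    + (suc k ℕ.+ s')       ≡⟨ a+[k-a]+1+x≡1+k+x k a s' ⟨
    + a + m + + 1 + + s'   ≡⟨ cong₂ (λ u v → + u + m + + 1 + + v) (sym j≡a) (sym h≡s') ⟩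
    + j + m + + 1 + + h    ∎
    where
    open ≡-Reasoning
    j≡a : j ≡ a
    j≡a = greatest-unique (RectFits α m) width
            (isDurfeeRectWidth {α} {k} (≤-reflexive α-row-1+k) a≤α-rows-above)
    h≡s' : h ≡ s'
    h≡s' = greatest-unique (HCond α m a) (subst (λ j → IsMaxH α m j h) j≡a maxH)
             (isMaxH {α} {k} {a} s'≤α-row-c α-rows-below)

lemma2p6 : (n : ℕ) (la : List ℕ) (s t : ℕ) → IsDMP n la s t →
    RankSetContains (alpha la s t) (sptCrank la s t)
    × ((j h : ℕ) →
        IsDurfeeRectWidth (alpha la s t) (sptCrank la s t) j →
        IsMaxH (alpha la s t) (sptCrank la s t) j h →
        + part (beta la s t) 1 ≡ + j + sptCrank la s t + + 1 + + h)
lemma2p6 n la zero t (_ , () , _)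
lemma2p6 n la (suc s') t ((desc , _) , _ , s≤durfee , s≤t , _ , conj-s≡conj-t)
  rewrite DoublyMarked.sptCrank≡m desc s≤durfee s≤t conj-s≡conj-t =
    rankSetContains , λ _ _ → β₁≡j+m+1+h
  where open DoublyMarked desc s≤durfee s≤t conj-s≡conj-t
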